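{- The function $\Sigma_{\infty}:\mathbb{N}\to\mathbb{N}$ is not ITTM-computable; that is, there is no $f\in IT\text{ - }\mathcal{C}$ with $f^{*}=\Sigma_{\infty}$.
   Context: Infinite-time Turing machines (ITTMs, in the sense of Hamkins and Lewis) are considered with three one-way infinite tapes (input, output, scratch), alphabet $\{0,1\}$, finitely many states including a special Limit state; at successor steps they act as ordinary Turing machines, and at limit steps each cell takes the limsup of its previous values, the head moves to the leftmost cell, and the machine enters the Limit state. $IT\text{ - }\mathcal{C}$ denotes the set of all (partial) functions from Cantor space to itself computable by such ITTMs. For $n\in\mathbb{N}$, $\widehat{n}$ denotes the unary code of $n$: ones in the first $n$ cells and zeros elsewhere. For $f\in IT\text{ - }\mathcal{C}$, the partial function $f^{*}:\mathbb{N}\to\mathbb{N}$ is given by $f^{*}(n)=k$ if $f(\widehat{n})=\widehat{k}$, undefined otherwise; a function $g:\mathbb{N}\to\mathbb{N}$ is ITTM-computable if $g=f^{*}$ for some $f\in IT\text{ - }\mathcal{C}$. For $n\in\mathbb{N}$, $BB_{\infty}\text{ - }n$ is the set of $f\in IT\text{ - }\mathcal{C}$ such that $f^{*}(0)$ is defined and $f$ is computable by an ITTM with at most $n$ non-halting, non-limit states, and $\Sigma_{\infty}(n)=\max_{f\in BB_{\infty}\text{ - }n} f^{*}(0)$. -}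

module Defs where

open import Data.Nat using (ℕ; zero; suc; _≤_; _<ᵇ_; _≡ᵇ_; pred)
open import Data.Bool using (Bool; true; false; if_then_else_)
open import Data.Fin using (Fin)
open import Data.Maybe using (Maybe; just; nothing)
open import Data.Product using (Σ; _×_; _,_)
open import Data.Sum using (_⊎_)
open import Data.Empty using (⊥)
open import Relation.Nullary using (¬_)
open import Relation.Binary.PropositionalEquality using (_≡_)
open import Relation.Binary.Structures using (IsStrictTotalOrder)
open import Induction.WellFounded using (WellFounded)
open import Function.Bundles using (_⇔_)

Cantor : Set
Cantor = ℕ → Bool

unary : ℕ → Cantor
unary n i = i <ᵇ n

data Dir : Set where
  L R : Dir

-- States of a machine with n ordinary (non-halting, non-limit) states,
-- plus the special Limit state and the Halt state.
data St (n : ℕ) : Set where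
  wk     : Fin n → St n
  limSt  : St n
  haltSt : St n

Active : ℕ → Set
Active n = Maybe (Fin n)

toSt : {n : ℕ} → Active n → St n
toSt (just q) = wk q
toSt nothing  = limSt

-- An ITTM (Hamkins–Lewis): one head over three one-way infinite tapes
-- (input, output, scratch).
record Machine (n : ℕ) : Set where
  field
    start : Active n
    δ     : Active n → Bool → Bool → Bool → St n × Bool × Bool × Bool × Dir

record Config (n : ℕ) : Set where
  constructor cfg
  field
    state : St n
    head  : ℕ
    inT   : Cantor
    outT  : Cantor
    scrT  : Cantor
open Config public

write : Cantor → ℕ → Bool → Cantor
write t h b i = if i ≡ᵇ h then b else t i

move : Dir → ℕ → ℕ
move L h = pred h     -- moving left from cell 0 stays at cell 0
move R h = suc h

act : {n : ℕ} → Machine n → Active n → ℕ → Cantor → Cantor → Cantor → Config n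
act M s h a b c with Machine.δ M s (a h) (b h) (c h)
... | s' , a' , b' , c' , d = cfg s' (move d h) (write a h a') (write b h b') (write c h c')

step : {n : ℕ} → Machine n → Config n → Config n
step M (cfg (wk q) h a b c)   = act M (just q) h a b c
step M (cfg limSt h a b c)    = act M nothing h a b c
step M (cfg haltSt h a b c)   = cfg haltSt h a b c

initial : {n : ℕ} → Machine n → Cantor → Config n
initial M x = cfg (toSt (Machine.start M)) 0 x (λ _ → false) (λ _ → false)

_≈C_ : {n : ℕ} → Config n → Config n → Set
c ≈C d = (state c ≡ state d) × (head c ≡ head d)
       × ((i : ℕ) → inT c i ≡ inT d i)
       × ((i : ℕ) → outT c i ≡ outT d i)
       × ((i : ℕ) → scrT c i ≡ scrT d i)

-- A halting computation of M on input x with output y: a well-ordered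
-- index set W (an ordinal) with a greatest element `top`, and a sequence of
-- configurations obeying the initial, successor and limit (limsup) rules,
-- which is non-halting before `top` and halting at `top` with output y.
record Run {n : ℕ} (M : Machine n) (x y : Cantor) : Set₁ where
  field
    W    : Set
    _≺_  : W → W → Set
    isSTO : IsStrictTotalOrder _≡_ _≺_
    wf   : WellFounded _≺_
    c    : W → Config n
    top  : W
  IsZero : W → Set
  IsZero γ = (β : W) → ¬ (β ≺ γ)
  IsPred : W → W → Set
  IsPred β γ = (β ≺ γ) × ((δ : W) → δ ≺ γ → (δ ≺ β) ⊎ (δ ≡ β))
  IsLimit : W → Set
  IsLimit γ = ¬ IsZero γ × ((β : W) → ¬ IsPred β γ)
  LimSup : (Config n → Cantor) → W → ℕ → Set
  LimSup t γ i = (β : W) → β ≺ γ →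
    Σ W λ δ → ((β ≺ δ) ⊎ (β ≡ δ)) × (δ ≺ γ) × (t (c δ) i ≡ true)
  field
    isTop     : (β : W) → (β ≺ top) ⊎ (β ≡ top)
    zeroRule  : (γ : W) → IsZero γ → c γ ≈C initial M x
    succRule  : (β γ : W) → IsPred β γ → c γ ≈C step M (c β)
    limitRule : (γ : W) → IsLimit γ →
      (state (c γ) ≡ limSt) × (head (c γ) ≡ 0)
      × ((i : ℕ) → (inT (c γ) i ≡ true) ⇔ LimSup inT γ i)
      × ((i : ℕ) → (outT (c γ) i ≡ true) ⇔ LimSup outT γ i)
      × ((i : ℕ) → (scrT (c γ) i ≡ true) ⇔ LimSup scrT γ i)
    notHalted : (β : W) → β ≺ top → ¬ (state (c β) ≡ haltSt)
    halted    : state (c top) ≡ haltSt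
    output    : (i : ℕ) → outT (c top) i ≡ y i

Halts : {n : ℕ} → Machine n → Cantor → Cantor → Set₁
Halts M x y = Run M x y

-- IsΣ∞ n k : "Σ∞(n) = k", i.e. k is the maximum of f*(0) over all f
-- computable by an ITTM with at most n ordinary states and f*(0) defined.
IsΣ∞ : ℕ → ℕ → Set₁
IsΣ∞ n k =
  (Σ ℕ λ m → (m ≤ n) × Σ (Machine m) λ M → Halts M (unary 0) (unary k))
  × ((m : ℕ) → m ≤ n → (M : Machine m) → (k' : ℕ) →
       Halts M (unary 0) (unary k') → k' ≤ k)

ComputesΣ∞ : {m : ℕ} → Machine m → Set₁
ComputesΣ∞ M = (n : ℕ) → Σ ℕ λ k → IsΣ∞ n k × Halts M (unary n) (unary k)

-- Suppose an m-state machine M computes Σ∞. From it we build a machine with N = 2m + 12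
-- ordinary states which, started on input 0, first writes b = 2(m + 6) ≥ N ones on its input
-- tape (m + 6 ones by a chain of states, then doubled by a loop of constantly many states),
-- then runs M, obtaining Σ∞(b) in unary, and finally lengthens the output by at least one.
-- Its output then exceeds Σ∞(b) ≥ Σ∞(N), although as an N-state machine it outputs at most
-- Σ∞(N). The transfinite run of the new machine is the run of M with finitely many steps
-- prepended and appended to its well-order.

module Submission where

open import Defs
open import Data.Bool using (Bool; true; false; _∧_; _∨_)
open import Data.Empty using (⊥; ⊥-elim)
open import Data.Fin using (Fin; zero; suc; _↑ˡ_; _↑ʳ_; splitAt; toℕ; inject₁; fromℕ)
open import Data.Fin.Properties using (splitAt-↑ˡ; splitAt-↑ʳ; toℕ-inject₁; toℕ-fromℕ)
open import Data.Maybe using (just; nothing)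
open import Data.Nat using (ℕ; zero; suc; _+_; pred; _≤_; _<_; z≤n; s≤s; s≤s⁻¹; _<?_)
open import Data.Nat using (_≤′_; ≤′-refl; ≤′-step; _≤ᵇ_; _<ᵇ_; _≡ᵇ_)
open import Data.Nat.Properties
open import Data.Product using (Σ; _×_; _,_; proj₁; proj₂)
open import Data.Sum using (_⊎_; inj₁; inj₂; [_,_]′)
open import Function using (_∘_)
open import Function.Bundles using (_⇔_; mk⇔; Equivalence)
import Function.Properties.Equivalence as ⇔
open import Induction.WellFounded using (WellFounded; Acc; acc)
open import Relation.Binary.Definitions using (tri<; tri≈; tri>)
open import Relation.Binary.PropositionalEquality
open import Relation.Binary.Structures using (IsStrictTotalOrder)
open import Relation.Nullary using (¬_; Dec; yes; no)
open import Relation.Nullary.Reflects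
  using (Reflects; ofʸ; ofⁿ; det; fromEquivalence; _×-reflects_; _⊎-reflects_)
open import Relation.Nullary.Construct.Add.Infimum using (_₋; ⊥₋; [_])
open import Relation.Nullary.Construct.Add.Supremum using (_⁺; ⊤⁺)
import Relation.Binary.Construct.Add.Infimum.Strict as AddInfimum
import Relation.Binary.Construct.Add.Supremum.Strict as AddSupremum

Reflects-≡ : ∀ {A B : Set} {a b} → Reflects A a → Reflects B b → (A → B) → (B → A) → a ≡ b
Reflects-≡ (ofʸ _) (ofʸ _) _ _ = refl
Reflects-≡ (ofʸ x) (ofⁿ ¬y) f _ = ⊥-elim (¬y (f x))
Reflects-≡ (ofⁿ ¬x) (ofʸ y) _ g = ⊥-elim (¬x (g y))
Reflects-≡ (ofⁿ _) (ofⁿ _) _ _ = refl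

<ᵇ-true : ∀ {i n} → i < n → (i <ᵇ n) ≡ true
<ᵇ-true i<n = det (<ᵇ-reflects-< _ _) (ofʸ i<n)

<ᵇ-false : ∀ {i n} → n ≤ i → (i <ᵇ n) ≡ false
<ᵇ-false n≤i = det (<ᵇ-reflects-< _ _) (ofⁿ (≤⇒≯ n≤i))

≡ᵇ-reflects-≡ : ∀ i j → Reflects (i ≡ j) (i ≡ᵇ j)
≡ᵇ-reflects-≡ i j = fromEquivalence (≡ᵇ⇒≡ i j) (≡⇒≡ᵇ i j)

infix 4 _≈T_

_≈T_ : Cantor → Cantor → Set
s ≈T t = ∀ i → s i ≡ t i

blank : Cantor
blank _ = false

write-≈T : ∀ {t t′ : Cantor} {h v} → t′ h ≡ v → (∀ i → i ≢ h → t i ≡ t′ i) → write t h v ≈T t′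
write-≈T {h = h} t′h≡v agree i with i ≡ᵇ h | ≡ᵇ-reflects-≡ i h
... | true  | ofʸ refl = sym t′h≡v
... | false | ofⁿ i≢h = agree i i≢h

write-id : ∀ {t : Cantor} {h v} → t h ≡ v → write t h v ≈T t
write-id th≡v = write-≈T th≡v (λ _ _ → refl)

interval : ℕ → ℕ → Cantor
interval l r i = (l ≤ᵇ i) ∧ (i <ᵇ r)

interval-reflects : ∀ l r i → Reflects (l ≤ i × i < r) (interval l r i)
interval-reflects l r i = ≤ᵇ-reflects-≤ l i ×-reflects <ᵇ-reflects-< i r

interval-true : ∀ {l r i} → l ≤ i → i < r → interval l r i ≡ true
interval-true l≤i i<r = det (interval-reflects _ _ _) (ofʸ (l≤i , i<r))

interval-false : ∀ l r {i} → ¬ (l ≤ i × i < r) → interval l r i ≡ false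
interval-false l r ∉ = det (interval-reflects l r _) (ofⁿ ∉)

interval-right-end : ∀ l r → interval l r r ≡ false
interval-right-end l r = interval-false l r (λ (_ , r<r) → <-irrefl refl r<r)

interval-empty : ∀ l r → r ≤ l → interval l r ≈T blank
interval-empty l r r≤l i = interval-false l r (λ (l≤i , i<r) → <⇒≱ i<r (≤-trans r≤l l≤i))

interval-extendʳ : ∀ {l r} → l ≤ r → write (interval l r) r true ≈T interval l (suc r)
interval-extendʳ {l} {r} l≤r = write-≈T (interval-true l≤r ≤-refl) λ i i≢r →
  Reflects-≡ (interval-reflects l r i) (interval-reflects l (suc r) i)
    (λ (l≤i , i<r) → l≤i , m<n⇒m<1+n i<r)
    (λ (l≤i , i<1+r) → l≤i , ≤∧≢⇒< (s≤s⁻¹ i<1+r) i≢r)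

interval-off-left : ∀ {l r i} → i ≢ l → interval (suc l) r i ≡ interval l r i
interval-off-left {l} {r} {i} i≢l = Reflects-≡ (interval-reflects (suc l) r i) (interval-reflects l r i)
  (λ (l<i , i<r) → <⇒≤ l<i , i<r)
  (λ (l≤i , i<r) → ≤∧≢⇒< l≤i (≢-sym i≢l) , i<r)

interval-extendˡ : ∀ {l r} → l < r → write (interval (suc l) r) l true ≈T interval l r
interval-extendˡ {l} {r} l<r = write-≈T (interval-true ≤-refl l<r) (λ i → interval-off-left {l} {r} {i})

interval-shrinkˡ : ∀ l r → write (interval l r) l false ≈T interval (suc l) r
interval-shrinkˡ l r = write-≈T (interval-false (suc l) r (λ (l<l , _) → <-irrefl refl l<l))
  (λ i i≢l → sym (interval-off-left {l} {r} {i} i≢l))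

fillTape : ℕ → ℕ → ℕ → Cantor
fillTape K H lo i = (i <ᵇ K) ∨ interval lo (suc H) i

fillTape-reflects : ∀ K H lo i → Reflects (i < K ⊎ (lo ≤ i × i < suc H)) (fillTape K H lo i)
fillTape-reflects K H lo i = <ᵇ-reflects-< i K ⊎-reflects interval-reflects lo (suc H) i

fillTape-start : ∀ K h {o} → o ≈T unary K → write o h true ≈T fillTape K h h
fillTape-start K h o≈K = write-≈T (det (fillTape-reflects K h h h) (ofʸ (inj₂ (≤-refl , ≤-refl))))
  λ i i≢h → trans (o≈K i) (Reflects-≡ (<ᵇ-reflects-< i K) (fillTape-reflects K h h i) inj₁
    λ { (inj₁ i<K) → i<K ; (inj₂ (h≤i , i≤h)) → ⊥-elim (i≢h (≤-antisym (s≤s⁻¹ i≤h) h≤i)) })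

fillTape-extend : ∀ K H {lo} → lo ≤ H → write (fillTape K H (suc lo)) lo true ≈T fillTape K H lo
fillTape-extend K H {lo} lo≤H =
  write-≈T (det (fillTape-reflects K H lo lo) (ofʸ (inj₂ (≤-refl , s≤s lo≤H))))
  λ i i≢lo → cong ((i <ᵇ K) ∨_) (interval-off-left {lo} {suc H} {i} i≢lo)

fillTape-gap : ∀ K H {lo} → K ≤ lo → fillTape K H (suc lo) lo ≡ false
fillTape-gap K H {lo} K≤lo = det (fillTape-reflects K H (suc lo) lo)
  (ofⁿ λ { (inj₁ lo<K) → <⇒≱ lo<K K≤lo ; (inj₂ (lo<lo , _)) → <-irrefl refl lo<lo })

fillTape-last : ∀ K H → fillTape K H K (pred K) ≡ true
fillTape-last zero H = refl
fillTape-last (suc K) H = det (fillTape-reflects (suc K) H (suc K) K) (ofʸ (inj₁ (n<1+n K)))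

fillTape-full : ∀ K H → K ≤ suc H → fillTape K H K ≈T unary (suc H)
fillTape-full K H K≤1+H i = Reflects-≡ (fillTape-reflects K H K i) (<ᵇ-reflects-< i (suc H))
  (λ { (inj₁ i<K) → <-≤-trans i<K K≤1+H ; (inj₂ (_ , i<1+H)) → i<1+H })
  (λ i<1+H → split i<1+H (i <? K))
  where
  split : i < suc H → Dec (i < K) → i < K ⊎ (K ≤ i × i < suc H)
  split _ (yes i<K) = inj₁ i<K
  split i<1+H (no i≮K) = inj₂ (≮⇒≥ i≮K , i<1+H)

module _ {n : ℕ} where

  ≈C-refl : {x : Config n} → x ≈C x
  ≈C-refl = refl , refl , (λ _ → refl) , (λ _ → refl) , (λ _ → refl)

  ≈C-reflexive : {x y : Config n} → x ≡ y → x ≈C y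
  ≈C-reflexive refl = ≈C-refl

  ≈C-sym : {x y : Config n} → x ≈C y → y ≈C x
  ≈C-sym (q , h , i , o , s) = sym q , sym h , (sym ∘ i) , (sym ∘ o) , (sym ∘ s)

  ≈C-trans : {x y z : Config n} → x ≈C y → y ≈C z → x ≈C z
  ≈C-trans (q , h , i , o , s) (q′ , h′ , i′ , o′ , s′) =
    trans q q′ , trans h h′ ,
    (λ k → trans (i k) (i′ k)) , (λ k → trans (o k) (o′ k)) , (λ k → trans (s k) (s′ k))

  cfg-cong : ∀ {q h i o s i′ o′ s′} → i ≈T i′ → o ≈T o′ → s ≈T s′ →
    cfg {n} q h i o s ≈C cfg q h i′ o′ s′
  cfg-cong i≈ o≈ s≈ = refl , refl , i≈ , o≈ , s≈

Action : ℕ → Set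
Action n = St n × Bool × Bool × Bool × Dir

perform : ∀ {n} → Action n → ℕ → Cantor → Cantor → Cantor → Config n
perform (q , x , y , z , d) h i o s = cfg q (move d h) (write i h x) (write o h y) (write s h z)

write-cong : ∀ {t t′ : Cantor} → t ≈T t′ → ∀ h v → write t h v ≈T write t′ h v
write-cong t≈t′ h v i with i ≡ᵇ h
... | true  = refl
... | false = t≈t′ i

act-cong : ∀ {n} (M : Machine n) q h {i o s i′ o′ s′} → i ≈T i′ → o ≈T o′ → s ≈T s′ →
  act M q h i o s ≈C act M q h i′ o′ s′
act-cong M q h {i} {o} {s} i≈ o≈ s≈
  rewrite i≈ h | o≈ h | s≈ h = cfg-cong (write-cong i≈ h _) (write-cong o≈ h _) (write-cong s≈ h _)

step-cong : ∀ {n} (M : Machine n) {x y : Config n} → x ≈C y → step M x ≈C step M y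
step-cong M {cfg (wk q) h _ _ _} (refl , refl , i≈ , o≈ , s≈) = act-cong M (just q) h i≈ o≈ s≈
step-cong M {cfg limSt h _ _ _}  (refl , refl , i≈ , o≈ , s≈) = act-cong M nothing h i≈ o≈ s≈
step-cong M {cfg haltSt h _ _ _} (refl , refl , i≈ , o≈ , s≈) = cfg-cong i≈ o≈ s≈

-- Finite computations

Halted : ∀ {n} → Config n → Set
Halted x = state x ≡ haltSt

data Steps {n} (M : Machine n) : Config n → Config n → Set where
  done : ∀ {x y} → x ≈C y → Steps M x y
  next : ∀ {x y} → ¬ Halted x → Steps M (step M x) y → Steps M x y

module _ {n} {M : Machine n} where

  infixr 4 _⨾_

  _⨾_ : ∀ {x y z} → Steps M x y → Steps M y z → Steps M x z
  done x≈y   ⨾ done y≈z   = done (≈C-trans x≈y y≈z)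
  done x≈y   ⨾ next ¬hy r = next (¬hy ∘ trans (sym (proj₁ x≈y))) (done (step-cong M x≈y) ⨾ r)
  next ¬hx r ⨾ r′         = next ¬hx (r ⨾ r′)

  Steps-≈ʳ : ∀ {x y y′} → Steps M x y → y ≈C y′ → Steps M x y′
  Steps-≈ʳ r y≈y′ = r ⨾ done y≈y′

-- Transfinite computations

-- The notions used inside Run, for an arbitrary order; they agree with Run's definitionally.
module Positions {W : Set} (_≺_ : W → W → Set) where

  _≼_ : W → W → Set
  β ≼ δ = (β ≺ δ) ⊎ (β ≡ δ)

  IsZero : W → Set
  IsZero γ = (β : W) → ¬ (β ≺ γ)

  IsPred : W → W → Set
  IsPred β γ = (β ≺ γ) × ((δ : W) → δ ≺ γ → δ ≼ β)

  IsLimit : W → Set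
  IsLimit γ = ¬ IsZero γ × ((β : W) → ¬ IsPred β γ)

  LimSup : ∀ {n} → (W → Config n) → (Config n → Cantor) → W → ℕ → Set
  LimSup c t γ i = (β : W) → β ≺ γ →
    Σ W λ δ → (β ≼ δ) × (δ ≺ γ) × (t (c δ) i ≡ true)

  ¬¬-zero : WellFounded _≺_ → W → ¬ ¬ Σ W IsZero
  ¬¬-zero wf w ¬zero = descend w (wf w)
    where
    descend : ∀ x → Acc _≺_ x → ⊥
    descend x (acc rs) = ¬zero (x , λ β β≺x → descend β (rs β≺x))

  zero-≺ : IsStrictTotalOrder _≡_ _≺_ → ∀ {z w} → IsZero z → ¬ IsZero w → z ≺ w
  zero-≺ sto {z} {w} z₀ ¬w₀ with IsStrictTotalOrder.compare sto z w
  ... | tri< z≺w _ _ = z≺w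
  ... | tri≈ _ refl _ = ⊥-elim (¬w₀ z₀)
  ... | tri> _ _ w≺z = ⊥-elim (z₀ w w≺z)

LimitConfig : ∀ {n} → Config n → ((Config n → Cantor) → ℕ → Set) → Set
LimitConfig {n} x ls = (state x ≡ limSt) × (head x ≡ 0) × Agrees inT × Agrees outT × Agrees scrT
  where
  Agrees : (Config n → Cantor) → Set
  Agrees t = ∀ i → (t x i ≡ true) ⇔ ls t i

LimitConfig-⇔ : ∀ {n} {x : Config n} {ls ls′} → (∀ t i → ls t i ⇔ ls′ t i) →
  LimitConfig x ls → LimitConfig x ls′
LimitConfig-⇔ ls⇔ls′ (q , h , ai , ao , as) =
  q , h , (λ i → ⇔.trans (ai i) (ls⇔ls′ inT i)) , (λ i → ⇔.trans (ao i) (ls⇔ls′ outT i)) ,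
  (λ i → ⇔.trans (as i) (ls⇔ls′ scrT i))

-- Unlike Run, a least position is part of the data: prepending a step below a limit needs a
-- position under the limit, which ¬ IsZero does not provide constructively.
record RunFrom {n} (M : Machine n) (start finish : Config n) : Set₁ where
  field
    W     : Set
    _≺_   : W → W → Set
    isSTO : IsStrictTotalOrder _≡_ _≺_
    wf    : WellFounded _≺_
    c     : W → Config n
    top   : W
    bot   : W
  open Positions _≺_
  field
    bot-isZero : IsZero bot
    isTop      : (β : W) → β ≼ top
    zeroRule   : (γ : W) → IsZero γ → c γ ≈C start
    succRule   : (β γ : W) → IsPred β γ → c γ ≈C step M (c β)
    limitRule  : (γ : W) → IsLimit γ → LimitConfig (c γ) (λ t → LimSup c t γ)
    notHalted  : (β : W) → β ≺ top → ¬ Halted (c β)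
    topRule    : c top ≈C finish

module _ {n} {M : Machine n} where

  RunFrom⇒Run : ∀ {x y z} → RunFrom M (initial M x) z → Halted z → outT z ≈T y → Run M x y
  RunFrom⇒Run run z-halted z-out = record
    { W = W ; _≺_ = _≺_ ; isSTO = isSTO ; wf = wf ; c = c ; top = top
    ; isTop = isTop ; zeroRule = zeroRule ; succRule = succRule ; limitRule = limitRule
    ; notHalted = notHalted ; halted = trans (proj₁ topRule) z-halted
    ; output = λ i → trans (proj₁ (proj₂ (proj₂ (proj₂ topRule))) i) (z-out i) }
    where open RunFrom run

module AddBottom {W : Set} (_≺_ : W → W → Set) where
  open AddInfimum _≺_
  private
    module P = Positions _≺_
    module P₋ = Positions _<₋_

  ≼-[] : ∀ {d v} → d P.≼ v → [ d ] P₋.≼ [ v ]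
  ≼-[] (inj₁ d≺v) = inj₁ [ d≺v ]
  ≼-[] (inj₂ refl) = inj₂ refl

  []-≼ : ∀ {d v} → [ d ] P₋.≼ [ v ] → d P.≼ v
  []-≼ (inj₁ [ d≺v ]) = inj₁ d≺v
  []-≼ (inj₂ refl) = inj₂ refl

  IsPred-⊥₋ : ∀ {w} → P₋.IsPred ⊥₋ [ w ] → P.IsZero w
  IsPred-⊥₋ (_ , below) d d≺w with below [ d ] [ d≺w ]
  ... | inj₁ ()
  ... | inj₂ ()

  IsPred-[] : ∀ {v w} → P₋.IsPred [ v ] [ w ] → P.IsPred v w
  IsPred-[] ([ v≺w ] , below) = v≺w , λ d d≺w → []-≼ (below [ d ] [ d≺w ])

  IsLimit-[] : ∀ {w} → P₋.IsLimit [ w ] → P.IsLimit w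
  IsLimit-[] {w} (_ , ¬pred) = ¬zero , ¬pred′
    where
    ¬zero : ¬ P.IsZero w
    ¬zero w₀ = ¬pred ⊥₋ (⊥₋<[ w ] , λ { ⊥₋ _ → inj₂ refl ; [ d ] [ d≺w ] → ⊥-elim (w₀ d d≺w) })
    ¬pred′ : ∀ v → ¬ P.IsPred v w
    ¬pred′ v (v≺w , below) =
      ¬pred [ v ] ([ v≺w ] , λ { ⊥₋ _ → inj₁ ⊥₋<[ v ] ; [ d ] [ d≺w ] → ≼-[] (below d d≺w) })

  LimSup-[] : ∀ {n} (c : W ₋ → Config n) t {z w} i → z ≺ w →
    P.LimSup (c ∘ [_]) t w i ⇔ P₋.LimSup c t [ w ] i
  LimSup-[] c t {z} {w} i z≺w = mk⇔ to from
    where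
    to : P.LimSup (c ∘ [_]) t w i → P₋.LimSup c t [ w ] i
    to ls ⊥₋ _ with ls z z≺w
    ... | δ , _ , δ≺w , tδ = [ δ ] , inj₁ ⊥₋<[ δ ] , [ δ≺w ] , tδ
    to ls [ v ] [ v≺w ] with ls v v≺w
    ... | δ , v≼δ , δ≺w , tδ = [ δ ] , ≼-[] v≼δ , [ δ≺w ] , tδ
    from : P₋.LimSup c t [ w ] i → P.LimSup (c ∘ [_]) t w i
    from ls v v≺w with ls [ v ] [ v≺w ]
    ... | ⊥₋ , inj₁ () , _
    ... | ⊥₋ , inj₂ () , _
    ... | [ δ ] , v≼δ , [ δ≺w ] , tδ = δ , []-≼ v≼δ , δ≺w , tδ

module AddTop {W : Set} (_≺_ : W → W → Set) where
  open AddSupremum _≺_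
  private
    module P = Positions _≺_
    module P⁺ = Positions _<⁺_

  <⁺-wellFounded : WellFounded _≺_ → WellFounded _<⁺_
  <⁺-wellFounded wf [ w ] = acc-[] (wf w)
    where
    acc-[] : ∀ {w} → Acc _≺_ w → Acc _<⁺_ [ w ]
    acc-[] (acc rs) = acc λ { [ v≺w ] → acc-[] (rs v≺w) }
  <⁺-wellFounded wf ⊤⁺ = acc λ { {[ v ]} [ v ]<⊤⁺ → <⁺-wellFounded wf [ v ] }

  ≼-[] : ∀ {d v} → d P.≼ v → [ d ] P⁺.≼ [ v ]
  ≼-[] (inj₁ d≺v) = inj₁ [ d≺v ]
  ≼-[] (inj₂ refl) = inj₂ refl

  []-≼ : ∀ {d v} → [ d ] P⁺.≼ [ v ] → d P.≼ v
  []-≼ (inj₁ [ d≺v ]) = inj₁ d≺v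
  []-≼ (inj₂ refl) = inj₂ refl

  IsZero-[] : ∀ {w} → P.IsZero w ⇔ P⁺.IsZero [ w ]
  IsZero-[] = mk⇔ (λ { w₀ [ d ] [ d≺w ] → w₀ d d≺w }) (λ w₀ d d≺w → w₀ [ d ] [ d≺w ])

  IsPred-[] : ∀ {v w} → P⁺.IsPred [ v ] [ w ] → P.IsPred v w
  IsPred-[] ([ v≺w ] , below) = v≺w , λ d d≺w → []-≼ (below [ d ] [ d≺w ])

  IsLimit-[] : ∀ {w} → P⁺.IsLimit [ w ] → P.IsLimit w
  IsLimit-[] (¬zero , ¬pred) = ¬zero ∘ Equivalence.to IsZero-[] ,
    λ v (v≺w , below) → ¬pred [ v ] ([ v≺w ] , λ { [ d ] [ d≺w ] → ≼-[] (below d d≺w) })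

  module _ {top : W} (isTop : ∀ β → β P.≼ top) where

    IsPred-⊤⁺ : P⁺.IsPred [ top ] ⊤⁺
    IsPred-⊤⁺ = [ top ]<⊤⁺ , λ { [ d ] _ → ≼-[] (isTop d) }

    IsPred-⊤⁺-unique : IsStrictTotalOrder _≡_ _≺_ → ∀ {v} → P⁺.IsPred [ v ] ⊤⁺ → v ≡ top
    IsPred-⊤⁺-unique sto {v} (_ , below) with below [ top ] [ top ]<⊤⁺ | isTop v
    ... | inj₂ refl        | _           = refl
    ... | inj₁ [ top≺v ]   | inj₁ v≺top  = ⊥-elim (irrefl refl (≺-trans top≺v v≺top))
      where open IsStrictTotalOrder sto renaming (trans to ≺-trans)
    ... | inj₁ [ top≺top ] | inj₂ refl   = ⊥-elim (IsStrictTotalOrder.irrefl sto refl top≺top)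

  LimSup-[] : ∀ {n} (c : W ⁺ → Config n) t {w} i → P.LimSup (c ∘ [_]) t w i ⇔ P⁺.LimSup c t [ w ] i
  LimSup-[] c t {w} i = mk⇔ to from
    where
    to : P.LimSup (c ∘ [_]) t w i → P⁺.LimSup c t [ w ] i
    to ls [ v ] [ v≺w ] with ls v v≺w
    ... | δ , v≼δ , δ≺w , tδ = [ δ ] , ≼-[] v≼δ , [ δ≺w ] , tδ
    from : P⁺.LimSup c t [ w ] i → P.LimSup (c ∘ [_]) t w i
    from ls v v≺w with ls [ v ] [ v≺w ]
    ... | [ δ ] , v≼δ , [ δ≺w ] , tδ = δ , []-≼ v≼δ , δ≺w , tδ

module _ {n} {M : Machine n} where

  RunFrom-≈ : ∀ {x x′ y y′} → x ≈C x′ → RunFrom M x′ y → y ≈C y′ → RunFrom M x y′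
  RunFrom-≈ x≈x′ run y≈y′ = record
    { W = W ; _≺_ = _≺_ ; isSTO = isSTO ; wf = wf ; c = c ; top = top ; bot = bot ; bot-isZero = bot-isZero
    ; isTop = isTop ; zeroRule = λ γ γ₀ → ≈C-trans (zeroRule γ γ₀) (≈C-sym x≈x′) ; succRule = succRule
    ; limitRule = limitRule ; notHalted = notHalted ; topRule = ≈C-trans topRule y≈y′ }
    where open RunFrom run

  prepend-step : ∀ {x y} → ¬ Halted x → RunFrom M (step M x) y → RunFrom M x y
  prepend-step {x} ¬hx run = record
    { W = W ₋ ; _≺_ = _<₋_ ; isSTO = <₋-isStrictTotalOrder-≡ isSTO ; wf = <₋-wellFounded wf
    ; c = c₋ ; top = [ top ] ; bot = ⊥₋ ; bot-isZero = λ _ ()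
    ; isTop = isTop₋ ; zeroRule = zeroRule₋ ; succRule = succRule₋ ; limitRule = limitRule₋
    ; notHalted = notHalted₋ ; topRule = topRule }
    where
    open RunFrom run
    open AddInfimum _≺_
    open AddBottom _≺_
    module P₋ = Positions _<₋_
    c₋ : W ₋ → Config n
    c₋ ⊥₋ = x
    c₋ [ w ] = c w
    isTop₋ : ∀ β → β P₋.≼ [ top ]
    isTop₋ ⊥₋ = inj₁ ⊥₋<[ top ]
    isTop₋ [ v ] = ≼-[] (isTop v)
    zeroRule₋ : ∀ γ → P₋.IsZero γ → c₋ γ ≈C x
    zeroRule₋ ⊥₋ _ = ≈C-refl
    zeroRule₋ [ w ] w₀ = ⊥-elim (w₀ ⊥₋ ⊥₋<[ w ])
    succRule₋ : ∀ β γ → P₋.IsPred β γ → c₋ γ ≈C step M (c₋ β)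
    succRule₋ ⊥₋ [ w ] pred = zeroRule w (IsPred-⊥₋ pred)
    succRule₋ [ v ] [ w ] pred = succRule v w (IsPred-[] pred)
    succRule₋ _ ⊥₋ (() , _)
    limitRule₋ : ∀ γ → P₋.IsLimit γ → LimitConfig (c₋ γ) (λ t → P₋.LimSup c₋ t γ)
    limitRule₋ ⊥₋ (¬zero , _) = ⊥-elim (¬zero λ _ ())
    limitRule₋ [ w ] lim = LimitConfig-⇔ (λ t i → LimSup-[] c₋ t i bot≺w) (limitRule w (IsLimit-[] lim))
      where bot≺w = Positions.zero-≺ _≺_ isSTO bot-isZero (proj₁ (IsLimit-[] lim))
    notHalted₋ : ∀ β → β <₋ [ top ] → ¬ Halted (c₋ β)
    notHalted₋ ⊥₋ _ = ¬hx
    notHalted₋ [ v ] [ v≺top ] = notHalted v v≺top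

  append-step : ∀ {x y} → RunFrom M x y → ¬ Halted y → RunFrom M x (step M y)
  append-step {x} {y} run ¬hy = record
    { W = W ⁺ ; _≺_ = _<⁺_ ; isSTO = <⁺-isStrictTotalOrder-≡ isSTO ; wf = <⁺-wellFounded wf
    ; c = c⁺ ; top = ⊤⁺ ; bot = [ bot ] ; bot-isZero = Equivalence.to IsZero-[] bot-isZero
    ; isTop = isTop⁺ ; zeroRule = zeroRule⁺ ; succRule = succRule⁺ ; limitRule = limitRule⁺
    ; notHalted = notHalted⁺ ; topRule = ≈C-refl }
    where
    open RunFrom run
    open AddSupremum _≺_
    open AddTop _≺_
    module P⁺ = Positions _<⁺_
    c⁺ : W ⁺ → Config n
    c⁺ [ w ] = c w
    c⁺ ⊤⁺ = step M y
    isTop⁺ : ∀ β → β P⁺.≼ ⊤⁺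
    isTop⁺ [ v ] = inj₁ [ v ]<⊤⁺
    isTop⁺ ⊤⁺ = inj₂ refl
    zeroRule⁺ : ∀ γ → P⁺.IsZero γ → c⁺ γ ≈C x
    zeroRule⁺ [ w ] w₀ = zeroRule w (Equivalence.from IsZero-[] w₀)
    zeroRule⁺ ⊤⁺ ⊤₀ = ⊥-elim (⊤₀ [ top ] [ top ]<⊤⁺)
    succRule⁺ : ∀ β γ → P⁺.IsPred β γ → c⁺ γ ≈C step M (c⁺ β)
    succRule⁺ [ v ] [ w ] pred = succRule v w (IsPred-[] pred)
    succRule⁺ [ v ] ⊤⁺ pred with IsPred-⊤⁺-unique isTop isSTO pred
    ... | refl = step-cong M (≈C-sym topRule)
    succRule⁺ ⊤⁺ _ (() , _)
    limitRule⁺ : ∀ γ → P⁺.IsLimit γ → LimitConfig (c⁺ γ) (λ t → P⁺.LimSup c⁺ t γ)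
    limitRule⁺ [ w ] lim = LimitConfig-⇔ (λ t i → LimSup-[] c⁺ t {w} i) (limitRule w (IsLimit-[] lim))
    limitRule⁺ ⊤⁺ (_ , ¬pred) = ⊥-elim (¬pred [ top ] (IsPred-⊤⁺ isTop))
    notHalted⁺ : ∀ β → β <⁺ ⊤⁺ → ¬ Halted (c⁺ β)
    notHalted⁺ [ v ] _ with isTop v
    ... | inj₁ v≺top = notHalted v v≺top
    ... | inj₂ refl = ¬hy ∘ trans (sym (proj₁ topRule))

  Steps-RunFrom : ∀ {x y z} → Steps M x y → RunFrom M y z → RunFrom M x z
  Steps-RunFrom (done x≈y) run = RunFrom-≈ x≈y run ≈C-refl
  Steps-RunFrom (next ¬hx r) run = prepend-step ¬hx (Steps-RunFrom r run)

  RunFrom-Steps : ∀ {x y z} → RunFrom M x y → Steps M y z → RunFrom M x z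
  RunFrom-Steps run (done y≈z) = RunFrom-≈ ≈C-refl run y≈z
  RunFrom-Steps run (next ¬hy r) = RunFrom-Steps (append-step run ¬hy) r

-- The machine built from M

Σ∞-mono : ∀ {n n′ k k′} → n ≤ n′ → IsΣ∞ n k → IsΣ∞ n′ k′ → k ≤ k′
Σ∞-mono n≤n′ ((m , m≤n , M , halts) , _) (_ , bounded) = bounded m (≤-trans m≤n n≤n′) M _ halts


pattern Init      = zero
pattern ScanLeft  = suc zero
pattern ScanRight = suc (suc zero)
pattern Clear     = suc (suc (suc zero))
pattern Rewind    = suc (suc (suc (suc zero)))
pattern Extend    = suc (suc (suc (suc (suc zero))))
pattern Fill      = suc (suc (suc (suc (suc (suc zero)))))
pattern Count j   = suc (suc (suc (suc (suc (suc (suc j))))))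

module Construction {m : ℕ} (M : Machine m) where

  countStates : ℕ
  countStates = 5 + m

  G : ℕ
  G = 7 + countStates

  N : ℕ
  N = m + G

  n₀ : ℕ
  n₀ = 1 + countStates

  b : ℕ
  b = n₀ + n₀

  N≤b : N ≤ b
  N≤b = ≤-reflexive (trans (+-comm m (12 + m)) (cong (6 +_) (+-comm (6 + m) m)))

  fresh : Fin G → St N
  fresh g = wk (m ↑ʳ g)

  embedSt : St m → St N
  embedSt (wk q) = wk (q ↑ˡ G)
  embedSt limSt  = limSt
  embedSt haltSt = fresh Extend

  embedAction : Action m → Action N
  embedAction (q , x , y , z , d) = embedSt q , x , y , z , d

  lastCount : Fin countStates
  lastCount = fromℕ (4 + m)

  -- Init and Count write m + 6 ones on the input tape and a marker in output cell 0. Each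
  -- ScanLeft/ScanRight round trip marks one more of the original ones on the scratch tape and
  -- appends a one to the input, doubling the block; at the marker, Clear erases the scratch tape
  -- and Rewind erases the marker and starts M. A halt of M becomes Extend, which walks right to
  -- the first blank output cell, and Fill then completes the output to a longer unary code.
  freshδ : Fin G → Bool → Bool → Bool → Action N
  freshδ Init            x     y     z     = fresh (Count lastCount) , true , true , z , R
  freshδ (Count (suc j)) x     y     z     = fresh (Count (inject₁ j)) , true , y , z , R
  freshδ (Count zero)    x     y     z     = fresh ScanLeft , true , y , z , R
  freshδ ScanLeft        false y     z     = fresh ScanLeft , false , y , z , L
  freshδ ScanLeft        true  y     false = fresh ScanRight , true , y , true , R
  freshδ ScanLeft        true  false true  = fresh ScanLeft , true , false , true , L
  freshδ ScanLeft        true  true  true  = fresh Clear , true , true , false , R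
  freshδ ScanRight       true  y     z     = fresh ScanRight , true , y , z , R
  freshδ ScanRight       false y     z     = fresh ScanLeft , true , y , true , R
  freshδ Clear           true  y     z     = fresh Clear , true , y , false , R
  freshδ Clear           false y     z     = fresh Rewind , false , y , z , L
  freshδ Rewind          x     false z     = fresh Rewind , x , false , z , L
  freshδ Rewind          x     true  z     = embedSt (toSt (Machine.start M)) , x , false , z , L
  freshδ Extend          x     true  z     = fresh Extend , x , true , z , R
  freshδ Extend          x     false z     = fresh Fill , x , true , z , L
  freshδ Fill            x     false z     = fresh Fill , x , true , z , L
  freshδ Fill            x     true  z     = haltSt , x , true , z , L

  δN : Active N → Bool → Bool → Bool → Action N
  δN nothing  x y z = embedAction (Machine.δ M nothing x y z)
  δN (just q) x y z =
    [ (λ q′ → embedAction (Machine.δ M (just q′) x y z)) , (λ g → freshδ g x y z) ]′ (splitAt m q)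

  MN : Machine N
  MN = record { start = just (m ↑ʳ Init) ; δ = δN }

  δN-fresh : ∀ g x y z → δN (just (m ↑ʳ g)) x y z ≡ freshδ g x y z
  δN-fresh g x y z rewrite splitAt-↑ʳ m G g = refl

  δN-embed : ∀ q x y z → δN (just (q ↑ˡ G)) x y z ≡ embedAction (Machine.δ M (just q) x y z)
  δN-embed q x y z rewrite splitAt-↑ˡ m q G = refl

  embed : Config m → Config N
  embed x = cfg (embedSt (state x)) (head x) (inT x) (outT x) (scrT x)

  embed-cong : ∀ {x y} → x ≈C y → embed x ≈C embed y
  embed-cong (q , rest) = cong embedSt q , rest

  embed-step : ∀ x → ¬ Halted x → step MN (embed x) ≈C embed (step M x)
  embed-step (cfg (wk q) h i o s) _ =
    ≈C-reflexive (cong (λ a → perform a h i o s) (δN-embed q (i h) (o h) (s h)))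
  embed-step (cfg limSt h i o s)  _ = ≈C-refl
  embed-step (cfg haltSt h i o s) ¬h = ⊥-elim (¬h refl)

  embed-halted : ∀ {x} → Halted x → embed x ≈C cfg (fresh Extend) (head x) (inT x) (outT x) (scrT x)
  embed-halted x-halted = cong embedSt x-halted , refl , (λ _ → refl) , (λ _ → refl) , (λ _ → refl)

  embed-run : ∀ {x y} (run : Run M x y) → Σ (Run.W run) (Positions.IsZero (Run._≺_ run)) →
    RunFrom MN (embed (initial M x)) (embed (Run.c run (Run.top run)))
  embed-run run (z , z₀) = record
    { W = W ; _≺_ = _≺_ ; isSTO = isSTO ; wf = wf ; c = embed ∘ c ; top = top ; bot = z ; bot-isZero = z₀
    ; isTop = isTop ; zeroRule = λ γ γ₀ → embed-cong (zeroRule γ γ₀)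
    ; succRule = λ β γ pred → ≈C-trans (embed-cong (succRule β γ pred))
                                       (≈C-sym (embed-step (c β) (notHalted-below (proj₁ pred))))
    ; limitRule = λ γ lim → let (q , rest) = limitRule γ lim in cong embedSt q , rest
    ; notHalted = λ β _ → embedSt-¬halted (state (c β)) ; topRule = ≈C-refl }
    where
    open Run run
    notHalted-below : ∀ {β γ} → β ≺ γ → ¬ Halted (c β)
    notHalted-below {β} {γ} β≺γ with isTop γ
    ... | inj₁ γ≺top = notHalted β (IsStrictTotalOrder.trans isSTO β≺γ γ≺top)
    ... | inj₂ refl  = notHalted β β≺γ
    embedSt-¬halted : ∀ q → ¬ embedSt q ≡ haltSt
    embedSt-¬halted (wk _) ()
    embedSt-¬halted limSt ()
    embedSt-¬halted haltSt ()

  fresh-step : ∀ {g h i o s a y} → freshδ g (i h) (o h) (s h) ≡ a → perform a h i o s ≈C y →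
    Steps MN (cfg (fresh g) h i o s) y
  fresh-step {g} {h} {i} {o} {s} δ≡a a≈y =
    next (λ ()) (done (≈C-trans (≈C-reflexive (cong (λ a → perform a h i o s) δN≡a)) a≈y))
    where δN≡a = trans (δN-fresh g _ _ _) δ≡a

  Keeps : Fin G → Dir → Bool → Bool → Bool → Set
  Keeps g d x y z = freshδ g x y z ≡ (fresh g , x , y , z , d)

  keep-step : ∀ {g d h i o s} → Keeps g d (i h) (o h) (s h) →
    Steps MN (cfg (fresh g) h i o s) (cfg (fresh g) (move d h) i o s)
  keep-step keeps = fresh-step keeps (cfg-cong (write-id refl) (write-id refl) (write-id refl))

  walkˡ : ∀ {g i o s j k} → j ≤′ k → (∀ p → j < p → p ≤ k → Keeps g L (i p) (o p) (s p)) →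
    Steps MN (cfg (fresh g) k i o s) (cfg (fresh g) j i o s)
  walkˡ ≤′-refl _ = done ≈C-refl
  walkˡ (≤′-step j≤′k) keeps =
    keep-step (keeps _ (s≤s (≤′⇒≤ j≤′k)) ≤-refl)
    ⨾ walkˡ j≤′k (λ p j<p p≤k → keeps p j<p (m≤n⇒m≤1+n p≤k))

  walkʳ : ∀ {g i o s j k} → j ≤′ k → (∀ p → j ≤ p → p < k → Keeps g R (i p) (o p) (s p)) →
    Steps MN (cfg (fresh g) j i o s) (cfg (fresh g) k i o s)
  walkʳ ≤′-refl _ = done ≈C-refl
  walkʳ (≤′-step j≤′k) keeps =
    walkʳ j≤′k (λ p j≤p p<k → keeps p j≤p (m<n⇒m<1+n p<k))
    ⨾ keep-step (keeps _ (≤′⇒≤ j≤′k) ≤-refl)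

  module _ {x y z : Bool} where

    scanLeft-blank : x ≡ false → Keeps ScanLeft L x y z
    scanLeft-blank refl = refl

    scanLeft-copied : x ≡ true → y ≡ false → z ≡ true → Keeps ScanLeft L x y z
    scanLeft-copied refl refl refl = refl

    scanLeft-mark : x ≡ true → z ≡ false → freshδ ScanLeft x y z ≡ (fresh ScanRight , true , y , true , R)
    scanLeft-mark refl refl = refl

    scanRight-one : x ≡ true → Keeps ScanRight R x y z
    scanRight-one refl = refl

    scanRight-end : x ≡ false → freshδ ScanRight x y z ≡ (fresh ScanLeft , true , y , true , R)
    scanRight-end refl = refl

    clear-one : x ≡ true → freshδ Clear x y z ≡ (fresh Clear , true , y , false , R)
    clear-one refl = refl

    clear-end : x ≡ false → freshδ Clear x y z ≡ (fresh Rewind , false , y , z , L)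
    clear-end refl = refl

    rewind-blank : y ≡ false → Keeps Rewind L x y z
    rewind-blank refl = refl

    extend-one : y ≡ true → Keeps Extend R x y z
    extend-one refl = refl

    extend-end : y ≡ false → freshδ Extend x y z ≡ (fresh Fill , x , true , z , L)
    extend-end refl = refl

    fill-blank : y ≡ false → freshδ Fill x y z ≡ (fresh Fill , x , true , z , L)
    fill-blank refl = refl

    fill-end : y ≡ true → freshδ Fill x y z ≡ (haltSt , x , true , z , L)
    fill-end refl = refl

  marker : Cantor
  marker = write blank 0 true

  marker-false : ∀ {p} → 0 < p → marker p ≡ false
  marker-false {suc _} _ = refl

  Counted : ℕ → Config N
  Counted r = cfg (fresh ScanLeft) r (interval 0 r) marker blank

  count : ∀ k (j : Fin countStates) → toℕ j ≡ k → ∀ h →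
    Steps MN (cfg (fresh (Count j)) h (interval 0 h) marker blank) (Counted (suc k + h))
  count zero    zero    _   h = fresh-step refl (cfg-cong (interval-extendʳ z≤n) (write-id refl) (write-id refl))
  count (suc k) (suc j) j≡k h =
    fresh-step refl (cfg-cong (interval-extendʳ z≤n) (write-id refl) (write-id refl))
    ⨾ Steps-≈ʳ (count k (inject₁ j) (trans (toℕ-inject₁ j) (suc-injective j≡k)) (suc h))
               (≈C-reflexive (cong Counted (+-suc (suc k) h)))

  Doubling : ℕ → ℕ → Config N
  Doubling l r = cfg (fresh ScanLeft) r (interval 0 r) marker (interval l r)

  initialise : Steps MN (initial MN (unary 0)) (Doubling n₀ n₀)
  initialise =
    fresh-step refl (cfg-cong (interval-extendʳ z≤n) (λ _ → refl) (write-id refl))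
    ⨾ Steps-≈ʳ (count (4 + m) lastCount (toℕ-fromℕ (4 + m)) 1)
               (≈C-trans (≈C-reflexive (cong Counted (+-comm (5 + m) 1)))
                         (cfg-cong (λ _ → refl) (λ _ → refl) (λ i → sym (interval-empty n₀ n₀ ≤-refl i))))

  double-once : ∀ {l r} → l ≤ r → Steps MN (Doubling (suc l) (suc r)) (Doubling l (suc (suc r)))
  double-once {l} {r} l≤r =
    keep-step (scanLeft-blank (interval-right-end 0 (suc r)))
    ⨾ walkˡ (≤⇒≤′ l≤r) (λ p l<p p≤r →
        scanLeft-copied (interval-true z≤n (s≤s p≤r)) (marker-false (≤-<-trans z≤n l<p))
                        (interval-true l<p (s≤s p≤r)))
    ⨾ fresh-step (scanLeft-mark (interval-true z≤n (s≤s l≤r))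
                                (interval-false (suc l) (suc r) (λ (l<l , _) → <-irrefl refl l<l)))
        (cfg-cong (write-id (interval-true z≤n (s≤s l≤r))) (write-id refl) (interval-extendˡ (s≤s l≤r)))
    ⨾ walkʳ (≤⇒≤′ (s≤s l≤r)) (λ p _ p<1+r → scanRight-one (interval-true z≤n p<1+r))
    ⨾ fresh-step (scanRight-end (interval-right-end 0 (suc r)))
        (cfg-cong (interval-extendʳ z≤n) (write-id refl) (interval-extendʳ (m≤n⇒m≤1+n l≤r)))

  double : ∀ l r → l ≤ r → Steps MN (Doubling l r) (Doubling 0 (l + r))
  double zero    r       _         = done ≈C-refl
  double (suc l) (suc r) (s≤s l≤r) =
    double-once l≤r
    ⨾ Steps-≈ʳ (double l (suc (suc r)) (m≤n⇒m≤1+n (m≤n⇒m≤1+n l≤r)))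
               (≈C-reflexive (cong (Doubling 0) (+-suc l (suc r))))

  seek-marker : ∀ e →
    Steps MN (Doubling 0 (suc e)) (cfg (fresh Clear) 1 (interval 0 (suc e)) marker (interval 1 (suc e)))
  seek-marker e =
    keep-step (scanLeft-blank (interval-right-end 0 (suc e)))
    ⨾ walkˡ (≤⇒≤′ z≤n) (λ p 0<p p≤e →
        scanLeft-copied (interval-true z≤n (s≤s p≤e)) (marker-false 0<p) (interval-true z≤n (s≤s p≤e)))
    ⨾ fresh-step refl (cfg-cong (write-id refl) (write-id refl) (interval-shrinkˡ 0 (suc e)))

  clear : ∀ {l r e} → l ≤′ r → r ≤ e →
    Steps MN (cfg (fresh Clear) l (interval 0 e) marker (interval l e))
             (cfg (fresh Clear) r (interval 0 e) marker (interval r e))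
  clear ≤′-refl _ = done ≈C-refl
  clear {r = suc r} {e} (≤′-step l≤′r) r<e =
    clear l≤′r (<⇒≤ r<e)
    ⨾ fresh-step (clear-one (interval-true z≤n r<e))
        (cfg-cong (write-id (interval-true z≤n r<e)) (write-id refl) (interval-shrinkˡ r e))

  rewind : ∀ e → Steps MN (cfg (fresh Clear) (suc e) (interval 0 (suc e)) marker (interval (suc e) (suc e)))
                          (embed (initial M (unary (suc e))))
  rewind e =
    fresh-step (clear-end (interval-right-end 0 (suc e)))
      (cfg-cong (write-id (interval-right-end 0 (suc e))) (write-id refl)
                (write-≈T (sym (interval-right-end (suc e) (suc e)))
                          (λ i _ → interval-empty (suc e) (suc e) ≤-refl i)))
    ⨾ walkˡ (≤⇒≤′ z≤n) (λ p 0<p _ → rewind-blank (marker-false 0<p))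
    ⨾ fresh-step refl (cfg-cong (write-id refl) (λ { zero → refl ; (suc _) → refl }) (write-id refl))

  prefix : Steps MN (initial MN (unary 0)) (embed (initial M (unary b)))
  prefix = initialise ⨾ double n₀ n₀ ≤-refl ⨾ seek-marker e ⨾ clear (≤⇒≤′ (s≤s z≤n)) ≤-refl ⨾ rewind e
    where e = 5 + m + n₀

  Outputs : Config N → ℕ → Set
  Outputs x k = Σ (Config N) λ z → Halted z × outT z ≈T unary k × Steps MN x z

  fill : ∀ {K H lo i s} → K ≤′ lo → lo ≤ suc H →
    Steps MN (cfg (fresh Fill) (pred lo) i (fillTape K H lo) s) (cfg (fresh Fill) (pred K) i (fillTape K H K) s)
  fill ≤′-refl _ = done ≈C-refl
  fill {K} {H} (≤′-step K≤′lo) lo<1+H =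
    fresh-step (fill-blank (fillTape-gap K H (≤′⇒≤ K≤′lo)))
      (cfg-cong (write-id refl) (fillTape-extend K H (s≤s⁻¹ lo<1+H)) (write-id refl))
    ⨾ fill K≤′lo (<⇒≤ lo<1+H)

  extend-from : ∀ {K h i o s} → K ≤ h → o ≈T unary K → Outputs (cfg (fresh Extend) h i o s) (suc h)
  extend-from {K} {h} K≤h o≈K =
    _ , refl ,
    (λ p → trans (write-id {fillTape K h K} (fillTape-last K h) p) (fillTape-full K h (m≤n⇒m≤1+n K≤h) p)) ,
    (fresh-step (extend-end (trans (o≈K h) (<ᵇ-false K≤h)))
       (cfg-cong (write-id refl) (fillTape-start K h o≈K) (write-id refl))
     ⨾ fill (≤⇒≤′ K≤h) (n≤1+n h)
     ⨾ fresh-step (fill-end (fillTape-last K h)) ≈C-refl)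

  extend : ∀ {K h i o s} → o ≈T unary K → Σ ℕ λ H → K < H × Outputs (cfg (fresh Extend) h i o s) H
  extend {K} {h} o≈K with K ≤? h
  ... | yes K≤h = suc h , s≤s K≤h , extend-from K≤h o≈K
  ... | no  K≰h with extend-from ≤-refl o≈K
  ...   | z , z-halted , z-out , steps =
    suc K , ≤-refl , z , z-halted , z-out ,
    (walkʳ (≤⇒≤′ (<⇒≤ (≰⇒> K≰h))) (λ p _ p<K → extend-one (trans (o≈K p) (<ᵇ-true p<K))) ⨾ steps)

  outruns : ∀ {K} → Run M (unary b) (unary K) → ¬ ¬ Σ ℕ λ H → K < H × Halts MN (unary 0) (unary H)
  outruns run beaten = ¬¬-zero wf top λ z →
    let (H , K<H , y , y-halted , y-out , extension) = extend output
        run-M  = RunFrom-≈ ≈C-refl (embed-run run z) (embed-halted halted)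
        run-MN = Steps-RunFrom prefix (RunFrom-Steps run-M extension)
    in beaten (H , K<H , RunFrom⇒Run run-MN y-halted y-out)
    where
    open Run run
    open Positions _≺_

corollary1 : ¬ (Σ ℕ λ m → Σ (Machine m) λ M → ComputesΣ∞ M)
corollary1 (m , M , computes) with computes (Construction.b M) | computes (Construction.N M)
... | K , Σ∞b≡K , M-halts | K′ , Σ∞N≡K′ , _ = outruns M-halts λ (H , K<H , MN-halts) →
  <-irrefl refl (begin-strict
    K  <⟨ K<H ⟩
    H  ≤⟨ proj₂ Σ∞N≡K′ N ≤-refl MN H MN-halts ⟩
    K′ ≤⟨ Σ∞-mono N≤b Σ∞N≡K′ Σ∞b≡K ⟩
    K  ∎)
  where
  open Construction M
  open ≤-Reasoning
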